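{- Let $(P,\Pi\cup\theta\Pi)$ be a permutation-bipartition pair and let $a,b\in S$ with $a\neq b$, $\theta a\neq\theta b$ and $a\equiv b\pmod\Pi$. Let $(P_{a,\theta a},\Pi_a\cup\theta\Pi_a)=(P,\Pi\cup\theta\Pi)|^{a\rightarrow b}_{\theta a\rightarrow\theta b}$. Then the map $$f:S(\Pi\cup\theta\Pi,\ a\rightarrow b,\ \theta a\rightarrow\theta b)\to S(\Pi_a\cup\theta\Pi_a),\qquad f(Q)=\big(((a,b)Q)/b\big)(\theta a,\theta b)/\theta b=:Q_{a,\theta a}$$ is a bijection, and for every $Q$ in its domain $$\|PQ\|=\|P_{a,\theta a}Q_{a,\theta a}\|+\delta_{a,bP}+\delta_{\theta aP_a,\theta b},$$ where $\delta$ is the Kronecker delta.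
   Context: Let $S$ and $S_\theta$ be disjoint finite sets of equal size and let $\theta$ be a fixed-point-free involution of $S\cup S_\theta$ mapping $S$ bijectively onto $S_\theta$. Permutations act on the right: $xP$ is the image of $x$, $x(PQ)=(xP)Q$, and a cycle $(x_1,\ldots,x_m)$ means $x_iP=x_{i+1}$, $x_mP=x_1$. $\|P\|$ denotes the number of cycles in the disjoint cycle decomposition of $P$ (fixed points counted as 1-cycles). A permutation-bipartition pair $(P,\Pi\cup\theta\Pi)$ consists of a permutation $P$ of $S\cup S_\theta$ such that whenever $(x_1,x_2,\ldots,x_m)$ is a cycle of $P$, $(\theta x_1,\theta x_m,\ldots,\theta x_2)$ is also a cycle of $P$, together with a partition $\Pi=\{\Pi_1,\ldots,\Pi_k\}$ of $S$ and $\theta\Pi=\{\theta\Pi_1,\ldots,\theta\Pi_k\}$. $a\equiv b\pmod\Pi$ means $a,b$ lie in a common block. An embedding (bi-rotation) of the pair is a permutation $Q$ of $S\cup S_\theta$ whose cycles are, for each block $\Pi_i=\{a_{1},\ldots,a_{m}\}$, a cycle $(a_{j_1},a_{j_2},\ldots,a_{j_m})$ together with the cycle $(\theta a_{j_m},\ldots,\theta a_{j_2},\theta a_{j_1})$, for some ordering $j_1,\ldots,j_m$ of $1,\ldots,m$; $S(\Pi\cup\theta\Pi)$ is the set of all embeddings, and $S(\Pi\cup\theta\Pi,a\rightarrow b,\theta a\rightarrow\theta b)=\{Q\in S(\Pi\cup\theta\Pi): aQ=b,\ \theta bQ=\theta a\}$. For an element $x$, $P/x$ is obtained by deleting $x$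 from the cycle decomposition of $P$, and $\Pi-x$ by deleting $x$ from its block. The reduction: $\Pi_a=\Pi-b$, $\theta\Pi_a=\theta\Pi-\theta b$; $P_a=P(b,a,bP)/b$ if $a\neq bP\neq b$; $P_a=P(b,a)/b$ if $a=bP\neq b$; $P_a=P/b$ if $bP=b$; $P_{a,\theta a}=(\theta a,\theta b,\theta bP_a^{ -1})P_a/\theta b$ if $\theta a\neq\theta bP_a^{ -1}\neq\theta b$; $P_{a,\theta a}=(\theta b,\theta a)P_a/\theta b$ if $\theta a=\theta bP_a^{ -1}\neq\theta b$; $P_{a,\theta a}=P_a/\theta b$ if $\theta bP_a^{ -1}=\theta b$; and $(P,\Pi\cup\theta\Pi)|^{a\rightarrow b}_{\theta a\rightarrow\theta b}=(P_{a,\theta a},\Pi_a\cup\theta\Pi_a)$. -}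

module Defs where

open import Data.Nat using (ℕ; zero; suc; _+_; _≤ᵇ_)
open import Data.Fin using (Fin; toℕ)
open import Data.Fin.Properties using () renaming (_≟_ to _≟F_)
open import Data.Sum using (_⊎_; inj₁; inj₂)
open import Data.Bool using (Bool; true; false; if_then_else_; _∧_; not)
open import Data.List using (List; []; _∷_; map; _++_; allFin; upTo)
open import Data.Product using (Σ; _×_; ∃)
open import Relation.Nullary.Decidable using (⌊_⌋)
open import Relation.Binary.PropositionalEquality using (_≡_)

-- Ground set S ∪ S_θ, modelled as two disjoint copies of Fin n:
-- S = inj₁-part, S_θ = inj₂-part.
X : ℕ → Set
X n = Fin n ⊎ Fin n

θ : ∀ {n} → X n → X n
θ (inj₁ i) = inj₂ i
θ (inj₂ i) = inj₁ i

eqX : ∀ {n} → X n → X n → Bool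
eqX (inj₁ i) (inj₁ j) = ⌊ i ≟F j ⌋
eqX (inj₂ i) (inj₂ j) = ⌊ i ≟F j ⌋
eqX (inj₁ _) (inj₂ _) = false
eqX (inj₂ _) (inj₁ _) = false

enumX : ∀ n → List (X n)
enumX n = map inj₁ (allFin n) ++ map inj₂ (allFin n)

-- An injective rank, used to pick a canonical representative of each cycle.
rank : ∀ {n} → X n → ℕ
rank {n} (inj₁ i) = toℕ i
rank {n} (inj₂ i) = n + toℕ i

iter : ∀ {A : Set} → (A → A) → ℕ → A → A
iter f zero x = x
iter f (suc k) x = f (iter f k x)

-- Permutations act on the right: x(PQ) = (xP)Q.
_⨾_ : ∀ {n} → (X n → X n) → (X n → X n) → X n → X n
(P ⨾ Q) x = Q (P x)

allB : ∀ {A : Set} → (A → Bool) → List A → Bool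
allB p [] = true
allB p (x ∷ xs) = p x ∧ allB p xs

countB : ∀ {A : Set} → (A → Bool) → List A → ℕ
countB p [] = zero
countB p (x ∷ xs) = if p x then suc (countB p xs) else countB p xs

-- x is the rank-minimal element of its f-orbit (orbits have size ≤ 2n).
isOrbitMin : ∀ {n} → (X n → X n) → X n → Bool
isOrbitMin {n} f x = allB (λ k → rank x ≤ᵇ rank (iter f k x)) (upTo (n + n))

-- Domains (sets of points a permutation lives on) are Boolean predicates;
-- a permutation of a domain D is a permutation of X fixing every point off D.
-- ‖ f ‖ on D : number of cycles of f on D (fixed points count as 1-cycles).
cycles : ∀ {n} → (X n → Bool) → (X n → X n) → ℕ
cycles {n} D f = countB (λ x → D x ∧ isOrbitMin f x) (enumX n)

fullD : ∀ {n} → X n → Bool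
fullD _ = true

redD : ∀ {n} → Fin n → X n → Bool
redD b x = not (eqX x (inj₁ b)) ∧ not (eqX x (inj₂ b))

-- Inverse of a function on the finite set X (by search; correct for bijections).
findInv : ∀ {n} → (X n → X n) → X n → List (X n) → X n
findInv f y [] = y
findInv f y (x ∷ xs) = if eqX (f x) y then x else findInv f y xs

invF : ∀ {n} → (X n → X n) → X n → X n
invF {n} f y = findInv f y (enumX n)

-- P / x : delete x from the cycle decomposition (x becomes a point off the domain).
del : ∀ {n} → X n → (X n → X n) → X n → X n
del x P y = if eqX y x then x else (if eqX (P y) x then P x else P y)

cyc2 : ∀ {n} → X n → X n → X n → X n
cyc2 u v y = if eqX y u then v else (if eqX y v then u else y)

cyc3 : ∀ {n} → X n → X n → X n → X n → X n
cyc3 u v w y = if eqX y u then v else (if eqX y v then w else (if eqX y w then u else y))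

redPa : ∀ {n} → (X n → X n) → Fin n → Fin n → X n → X n
redPa P a b =
  if eqX (P (inj₁ b)) (inj₁ b) then del (inj₁ b) P
  else (if eqX (inj₁ a) (P (inj₁ b)) then del (inj₁ b) (P ⨾ cyc2 (inj₁ b) (inj₁ a))
  else del (inj₁ b) (P ⨾ cyc3 (inj₁ b) (inj₁ a) (P (inj₁ b))))

redP : ∀ {n} → (X n → X n) → Fin n → Fin n → X n → X n
redP P a b =
  let Pa = redPa P a b
      ta = θ (inj₁ a)
      tb = θ (inj₁ b)
      c  = invF Pa tb
  in if eqX c tb then del tb Pa
     else (if eqX ta c then del tb (cyc2 tb ta ⨾ Pa)
     else del tb (cyc3 ta tb c ⨾ Pa))

redQ : ∀ {n} → Fin n → Fin n → (X n → X n) → X n → X n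
redQ a b Q = del (θ (inj₁ b)) (del (inj₁ b) (cyc2 (inj₁ a) (inj₁ b) ⨾ Q) ⨾ cyc2 (θ (inj₁ a)) (θ (inj₁ b)))

-- P is the permutation of a permutation-bipartition pair:
-- a permutation of S ∪ S_θ such that with every cycle (x1,…,xm) also
-- (θx1, θxm, …, θx2) is a cycle, i.e. (θ(xP))P = θx for all x.
record IsPairPerm {n} (P : X n → X n) : Set where
  field
    injective : ∀ x y → P x ≡ P y → x ≡ y
    θ-cycles  : ∀ x → P (θ (P x)) ≡ θ x

-- A partition Π of (the S-part of) a domain D is given by a block label c;
-- i ≡ j (mod Π) iff c i ≡ c j.  Q is an embedding (bi-rotation) of
-- (Π ∪ θΠ) on domain D iff Q is a permutation of D whose cycles are: for every
-- block B of Π a single cycle running through exactly the elements of B, and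
-- the reversed θ-image of that cycle.
record IsEmbedding {n} (D : X n → Bool) (c : Fin n → ℕ) (Q : X n → X n) : Set where
  field
    injective  : ∀ x y → Q x ≡ Q y → x ≡ y
    fixes-off  : ∀ x → D x ≡ false → Q x ≡ x
    block-pres : ∀ i → D (inj₁ i) ≡ true →
                 Σ (Fin n) λ j → (Q (inj₁ i) ≡ inj₁ j) × (c j ≡ c i)
    one-cycle  : ∀ i j → D (inj₁ i) ≡ true → D (inj₁ j) ≡ true → c i ≡ c j →
                 ∃ λ k → iter Q k (inj₁ i) ≡ inj₁ j
    θ-reverse  : ∀ i → D (inj₁ i) ≡ true → Q (θ (Q (inj₁ i))) ≡ θ (inj₁ i)

InDom : ∀ {n} → (Fin n → ℕ) → Fin n → Fin n → (X n → X n) → Set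
InDom c a b Q = IsEmbedding fullD c Q × (Q (inj₁ a) ≡ inj₁ b) × (Q (θ (inj₁ b)) ≡ θ (inj₁ a))

δ : ∀ {n} → X n → X n → ℕ
δ x y = if eqX x y then 1 else 0

module Submission where

-- Deleting a point x (f ↦ f/x)
-- changes orbit minima only on the orbit of x, and loses a cycle exactly when x is fixed;
-- as deletion commutes with relabelling by an involution, so does ‖_‖.
-- When aQ = b and θbQ = θa the deletions defining Q_{a,θa} remove fixed points, so
-- Q_{a,θa} = (a,b) Q (θa,θb).  This relabelling is its own inverse, and it maps the
-- bi-rotations with a → b, θb → θa onto the bi-rotations of the reduced pair.
-- For the count, (PQ)/b = P_a (a,b) Q, where b is fixed by PQ iff bP = a; relabelling by
-- (θa,θb) and deleting θb leaves P_{a,θa} Q_{a,θa}, where θb was fixed iff θaP_a = θb.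

open import Defs
open import Data.Nat using (ℕ; zero; suc; _+_; _*_; _∸_; _≤_; _<_; _≤ᵇ_; s≤s⁻¹; s<s⁻¹)
open import Data.Nat.Properties
open import Algebra.Properties.CommutativeSemigroup +-commutativeSemigroup using (xy∙z≈xz∙y)
open import Data.Nat.DivMod using (_%_; _/_; m≡m%n+[m/n]*n; m%n<n)
open import Data.Nat.Induction using (<-wellFounded)
open import Induction.WellFounded using (Acc; acc)
import Data.Fin as Fin
open import Data.Fin using (Fin; zero; suc; toℕ; join; splitAt; fromℕ<)
open import Data.Fin.Properties using (toℕ-injective; toℕ<n; pigeonhole; splitAt-join; any?; toℕ-fromℕ<)
  renaming (_≟_ to _≟F_)
open import Data.Sum using (_⊎_; inj₁; inj₂)
open import Data.Sum.Properties using (≡-dec; inj₁-injective; inj₂-injective)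
open import Data.Bool using (Bool; true; false; if_then_else_; _∧_; not; T)
open import Data.Bool.Properties using (∧-conicalˡ; ∧-conicalʳ; ∧-zeroʳ; ∧-identityʳ; ¬-not; not-injective; if-float)
open import Data.List using (List; []; _∷_; map; _++_; allFin; upTo; applyUpTo; tabulate)
open import Data.List.Properties using (map-tabulate)
open import Data.Product using (Σ; _×_; ∃-syntax; _,_; proj₁)
open import Data.Unit using (tt)
open import Relation.Nullary using (Dec; yes; no; ¬_; does; contradiction)
open import Relation.Nullary.Decidable using (isYes≗does; dec-true; dec-false)
open import Relation.Binary.PropositionalEquality
open import Function using (_∘_; id)
open import Data.List.Membership.Propositional using (_∈_)
open import Data.List.Membership.Propositional.Properties using (∈-map⁺; ∈-++⁺ˡ; ∈-++⁺ʳ; ∈-allFin)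
open import Data.List.Relation.Unary.Any using (here; there)

private variable n : ℕ

Injective : (X n → X n) → Set
Injective {n} f = (x y : X n) → f x ≡ f y → x ≡ y

infix 4 _≟X_
_≟X_ : (x y : X n) → Dec (x ≡ y)
x ≟X y = ≡-dec _≟F_ _≟F_ x y

eqX≡does : (x y : X n) → eqX x y ≡ does (x ≟X y)
eqX≡does (inj₁ i) (inj₁ j) = isYes≗does (i ≟F j)
eqX≡does (inj₂ i) (inj₂ j) = isYes≗does (i ≟F j)
eqX≡does (inj₁ _) (inj₂ _) = refl
eqX≡does (inj₂ _) (inj₁ _) = refl

eqX-≡ : {x y : X n} → x ≡ y → eqX x y ≡ true
eqX-≡ {x = x} {y} x≡y = trans (eqX≡does x y) (dec-true (x ≟X y) x≡y)

eqX-≢ : {x y : X n} → x ≢ y → eqX x y ≡ false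
eqX-≢ {x = x} {y} x≢y = trans (eqX≡does x y) (dec-false (x ≟X y) x≢y)

eqX-true : {x y : X n} → eqX x y ≡ true → x ≡ y
eqX-true {x = x} {y} e with x ≟X y
... | yes x≡y = x≡y
... | no x≢y with () ← trans (sym e) (eqX-≢ x≢y)

eqX-false : {x y : X n} → eqX x y ≡ false → x ≢ y
eqX-false {x = x} e refl with () ← trans (sym e) (eqX-≡ {x = x} refl)

eqX-sym : (x y : X n) → eqX x y ≡ eqX y x
eqX-sym x y with x ≟X y
... | yes refl = refl
... | no x≢y = trans (eqX-≢ x≢y) (sym (eqX-≢ (≢-sym x≢y)))

eqX-injective : {h : X n → X n} → Injective h → ∀ x y → eqX (h x) (h y) ≡ eqX x y
eqX-injective {h = h} inj x y with x ≟X y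
... | yes refl = trans (eqX-≡ {x = h x} refl) (sym (eqX-≡ {x = x} refl))
... | no x≢y = trans (eqX-≢ (λ e → x≢y (inj x y e))) (sym (eqX-≢ x≢y))

does-true : ∀ {A : Set} (d : Dec A) → does d ≡ true → A
does-true (yes a) _ = a

if-≡ : ∀ {A : Set} {x u : X n} {p q : A} → x ≡ u → (if eqX x u then p else q) ≡ p
if-≡ x≡u rewrite eqX-≡ x≡u = refl

if-≢ : ∀ {A : Set} {x u : X n} {p q : A} → x ≢ u → (if eqX x u then p else q) ≡ q
if-≢ x≢u rewrite eqX-≢ x≢u = refl

countB-cong : ∀ {A : Set} {p q : A → Bool} (xs : List A) → (∀ y → p y ≡ q y) → countB p xs ≡ countB q xs
countB-cong [] p≗q = refl
countB-cong {q = q} (x ∷ xs) p≗q rewrite p≗q x with q x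
... | true = cong suc (countB-cong xs p≗q)
... | false = countB-cong xs p≗q

countB-++ : ∀ {A : Set} (p : A → Bool) (xs ys : List A) → countB p (xs ++ ys) ≡ countB p xs + countB p ys
countB-++ p [] ys = refl
countB-++ p (x ∷ xs) ys with p x
... | true = cong suc (countB-++ p xs ys)
... | false = countB-++ p xs ys

countB-map : ∀ {A B : Set} (p : B → Bool) (f : A → B) (xs : List A) → countB p (map f xs) ≡ countB (p ∘ f) xs
countB-map p f [] = refl
countB-map p f (x ∷ xs) with p (f x)
... | true = cong suc (countB-map p f xs)
... | false = countB-map p f xs

countB-false : ∀ {A : Set} {p : A → Bool} (xs : List A) → (∀ y → p y ≡ false) → countB p xs ≡ 0
countB-false [] p≗false = refl
countB-false (x ∷ xs) p≗false rewrite p≗false x = countB-false xs p≗false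

countB-∧-split : ∀ {A : Set} (p q : A → Bool) (xs : List A) →
  countB p xs ≡ countB (λ y → p y ∧ q y) xs + countB (λ y → p y ∧ not (q y)) xs
countB-∧-split p q [] = refl
countB-∧-split p q (x ∷ xs) with p x | q x
... | false | _ = countB-∧-split p q xs
... | true | true = cong suc (countB-∧-split p q xs)
... | true | false = trans (cong suc (countB-∧-split p q xs)) (sym (+-suc _ _))

countB-tabulate : ∀ {A : Set} (p : A → Bool) {m} (f : Fin m → A) →
  countB p (tabulate f) ≡ countB (p ∘ f) (allFin m)
countB-tabulate p f = trans (cong (countB p) (sym (map-tabulate id f))) (countB-map p f (allFin _))

countB-≟-allFin : ∀ m (i : Fin m) → countB (λ j → does (j ≟F i)) (allFin m) ≡ 1
countB-≟-allFin (suc m) zero = cong suc (trans (countB-tabulate _ (Fin.suc {m})) (countB-false (allFin m) λ _ → refl))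
countB-≟-allFin (suc m) (suc i) = trans (countB-tabulate _ (Fin.suc {m})) (countB-≟-allFin m i)

countB-eqX : (u : X n) → countB (λ y → eqX y u) (enumX n) ≡ 1
countB-eqX {n} u = begin
    countB (λ y → eqX y u) (enumX n)
  ≡⟨ countB-cong (enumX n) (λ y → eqX≡does y u) ⟩
    countB (λ y → does (y ≟X u)) (map inj₁ (allFin n) ++ map inj₂ (allFin n))
  ≡⟨ countB-++ _ (map inj₁ (allFin n)) _ ⟩
    countB (λ y → does (y ≟X u)) (map inj₁ (allFin n)) + countB (λ y → does (y ≟X u)) (map inj₂ (allFin n))
  ≡⟨ cong₂ _+_ (countB-map _ inj₁ (allFin n)) (countB-map _ inj₂ (allFin n)) ⟩
    countB (λ j → does (inj₁ j ≟X u)) (allFin n) + countB (λ j → does (inj₂ j ≟X u)) (allFin n)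
  ≡⟨ halves u ⟩
    1 ∎
  where
  open ≡-Reasoning
  halves : (u : X n) → countB (λ j → does (inj₁ j ≟X u)) (allFin n) + countB (λ j → does (inj₂ j ≟X u)) (allFin n) ≡ 1
  halves (inj₁ i) = cong₂ _+_ (countB-≟-allFin n i) (countB-false (allFin n) λ _ → refl)
  halves (inj₂ i) = cong₂ _+_ (countB-false (allFin n) λ _ → refl) (countB-≟-allFin n i)

countB-point : {p : X n → Bool} (u : X n) → (∀ y → p y ≡ eqX y u) → countB p (enumX n) ≡ 1
countB-point {n} u p≗u = trans (countB-cong (enumX n) p≗u) (countB-eqX u)

≡eqX : {q : X n → Bool} {m : X n} → q m ≡ true → (∀ y → q y ≡ true → y ≡ m) → ∀ y → q y ≡ eqX y m
≡eqX {q = q} {m} qm only-m y with q y in qy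
... | true = sym (eqX-≡ {x = y} {m} (only-m y qy))
... | false = sym (eqX-≢ {x = y} {m} λ { refl → contradiction (trans (sym qy) qm) λ () })

countB-remove : {p : X n → Bool} (u : X n) → p u ≡ true →
  countB p (enumX n) ≡ suc (countB (λ y → p y ∧ not (eqX y u)) (enumX n))
countB-remove {n} {p} u pu =
  trans (countB-∧-split p (λ y → eqX y u) (enumX n)) (cong (_+ countB (λ y → p y ∧ not (eqX y u)) (enumX n)) (countB-point u (≡eqX pu∧u only-u)))
  where
  pu∧u : p u ∧ eqX u u ≡ true
  pu∧u rewrite pu = eqX-≡ {x = u} refl
  only-u : ∀ y → p y ∧ eqX y u ≡ true → y ≡ u
  only-u y e = eqX-true (∧-conicalʳ (p y) _ e)

countB-witness : ∀ {A : Set} (p : A → Bool) (xs : List A) {m} → countB p xs ≡ suc m → ∃[ y ] p y ≡ true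
countB-witness p (x ∷ xs) e with p x in px
... | true = x , px
... | false = countB-witness p xs e

-- Orbits and their minima

rank-injective : (x y : X n) → rank x ≡ rank y → x ≡ y
rank-injective (inj₁ i) (inj₁ j) e = cong inj₁ (toℕ-injective e)
rank-injective {n} (inj₂ i) (inj₂ j) e = cong inj₂ (toℕ-injective (+-cancelˡ-≡ n _ _ e))
rank-injective {n} (inj₁ i) (inj₂ j) e = contradiction e (<⇒≢ (≤-trans (toℕ<n i) (m≤m+n n (toℕ j))))
rank-injective {n} (inj₂ i) (inj₁ j) e = contradiction (sym e) (<⇒≢ (≤-trans (toℕ<n j) (m≤m+n n (toℕ i))))

iter-+ : ∀ {A : Set} (f : A → A) k m x → iter f (k + m) x ≡ iter f k (iter f m x)
iter-+ f zero m x = refl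
iter-+ f (suc k) m x = cong f (iter-+ f k m x)

iter-cong : ∀ {A : Set} {f g : A → A} → (∀ y → f y ≡ g y) → ∀ k x → iter f k x ≡ iter g k x
iter-cong f≗g zero x = refl
iter-cong {g = g} f≗g (suc k) x = trans (f≗g _) (cong g (iter-cong f≗g k x))

iter-fixed : ∀ {A : Set} {f : A → A} {x : A} → f x ≡ x → ∀ k → iter f k x ≡ x
iter-fixed fx≡x zero = refl
iter-fixed {f = f} fx≡x (suc k) = trans (cong f (iter-fixed fx≡x k)) fx≡x

iter-periodic : ∀ {A : Set} (f : A → A) {p y} → iter f p y ≡ y → ∀ q → iter f (q * p) y ≡ y
iter-periodic f e zero = refl
iter-periodic f {p} {y} e (suc q) = trans (iter-+ f p (q * p) y) (trans (cong (iter f p) (iter-periodic f e q)) e)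

iter-injective : {f : X n → X n} → Injective f → ∀ k → Injective (iter f k)
iter-injective inj zero x y e = e
iter-injective inj (suc k) x y e = iter-injective inj k x y (inj _ _ e)

Reach : (X n → X n) → X n → X n → Set
Reach f y z = ∃[ k ] iter f k y ≡ z

Reach-refl : {f : X n → X n} (y : X n) → Reach f y y
Reach-refl y = 0 , refl

Reach-step : {f : X n → X n} (y : X n) → Reach f y (f y)
Reach-step y = 1 , refl

Reach-trans : {f : X n → X n} {x y z : X n} → Reach f x y → Reach f y z → Reach f x z
Reach-trans {f = f} {x} (k , refl) (m , refl) = m + k , iter-+ f m k x

iter-agree : {f g : X n → X n} (Good : X n → Set) → (∀ w → Good w → f w ≡ g w) → (∀ w → Good w → Good (f w)) →
  ∀ {y} → Good y → ∀ k → iter f k y ≡ iter g k y × Good (iter f k y)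
iter-agree Good f≡g closed good-y zero = refl , good-y
iter-agree {f = f} {g} Good f≡g closed good-y (suc k) with iter-agree Good f≡g closed good-y k
... | fk≡gk , good-k = trans (f≡g _ good-k) (cong g fk≡gk) , closed _ good-k

Reach-agree : {f g : X n → X n} (Good : X n → Set) → (∀ w → Good w → f w ≡ g w) → (∀ w → Good w → Good (f w)) →
  ∀ {y z} → Good y → Reach f y z → Reach g y z
Reach-agree Good f≡g closed good-y (k , refl) = k , sym (proj₁ (iter-agree Good f≡g closed good-y k))

Reach-simulation : {f g : X n → X n} (Good : X n → Set) → (∀ w → Good w → Reach g w (f w)) → (∀ w → Good w → Good (f w)) →
  ∀ {y z} → Good y → Reach f y z → Reach g y z
Reach-simulation Good step closed {y} good-y (zero , refl) = Reach-refl y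
Reach-simulation {f = f} Good step closed {y} good-y (suc k , refl) =
  Reach-trans (Reach-simulation Good step closed good-y (k , refl)) (step _ (good-iter k))
  where
  good-iter : ∀ k → Good (iter f k y)
  good-iter zero = good-y
  good-iter (suc k) = closed _ (good-iter k)

-- By pigeonhole on the first n + n + 1 iterates.
period : {f : X n → X n} → Injective f → ∀ y → ∃[ e ] suc e ≤ n + n × iter f (suc e) y ≡ y
period {n} {f} inj y with pigeonhole (n<1+n (n + n)) (λ k → join n n (iter f (toℕ k) y))
... | i , j , i<j , eq = e , e<n+n , returns
  where
  e = toℕ j ∸ suc (toℕ i)
  i+e : toℕ i + suc e ≡ toℕ j
  i+e = trans (+-suc (toℕ i) e) (m+[n∸m]≡n i<j)
  iter-i≡iter-j : iter f (toℕ i) y ≡ iter f (toℕ j) y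
  iter-i≡iter-j = trans (sym (splitAt-join n n _)) (trans (cong (splitAt n) eq) (splitAt-join n n _))
  returns : iter f (suc e) y ≡ y
  returns = iter-injective inj (toℕ i) _ _ (begin
      iter f (toℕ i) (iter f (suc e) y)  ≡⟨ sym (iter-+ f (toℕ i) (suc e) y) ⟩
      iter f (toℕ i + suc e) y           ≡⟨ cong (λ k → iter f k y) i+e ⟩
      iter f (toℕ j) y                   ≡⟨ sym iter-i≡iter-j ⟩
      iter f (toℕ i) y                   ∎)
    where open ≡-Reasoning
  e<n+n : suc e ≤ n + n
  e<n+n = ≤-trans (subst (suc e ≤_) i+e (m≤n+m (suc e) (toℕ i))) (s≤s⁻¹ (toℕ<n j))

Reach-bounded : {f : X n → X n} → Injective f → ∀ y k → ∃[ k' ] k' < n + n × iter f k y ≡ iter f k' y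
Reach-bounded {n} {f} inj y k with period inj y
... | e , e<n+n , returns = k % suc e , ≤-trans (m%n<n k (suc e)) e<n+n , (begin
    iter f k y                                     ≡⟨ cong (λ j → iter f j y) (m≡m%n+[m/n]*n k (suc e)) ⟩
    iter f (k % suc e + (k / suc e) * suc e) y     ≡⟨ iter-+ f (k % suc e) _ y ⟩
    iter f (k % suc e) (iter f ((k / suc e) * suc e) y)
                                                   ≡⟨ cong (iter f (k % suc e)) (iter-periodic f returns (k / suc e)) ⟩
    iter f (k % suc e) y                           ∎)
  where open ≡-Reasoning

Reach-sym : {f : X n → X n} → Injective f → {y z : X n} → Reach f y z → Reach f z y
Reach-sym {f = f} inj {y} (k , refl) with period inj y
... | e , _ , returns = k * e , (begin
    iter f (k * e) (iter f k y)   ≡⟨ sym (iter-+ f (k * e) k y) ⟩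
    iter f (k * e + k) y          ≡⟨ cong (λ j → iter f j y) (trans (+-comm (k * e) k) (sym (*-suc k e))) ⟩
    iter f (k * suc e) y          ≡⟨ iter-periodic f returns k ⟩
    y                             ∎)
  where open ≡-Reasoning

Reach? : {f : X n → X n} → Injective f → ∀ y z → Dec (Reach f y z)
Reach? {n} {f} inj y z with any? {n = n + n} (λ k → iter f (toℕ k) y ≟X z)
... | yes (k , e) = yes (toℕ k , e)
... | no unreachable = no λ (k , e) → let (k' , k'<n+n , eq) = Reach-bounded inj y k in
        unreachable (fromℕ< k'<n+n , trans (cong (λ j → iter f j y) (toℕ-fromℕ< k'<n+n)) (trans (sym eq) e))

allB-cong : ∀ {A : Set} {q q' : A → Bool} (xs : List A) → (∀ k → q k ≡ q' k) → allB q xs ≡ allB q' xs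
allB-cong [] q≗q' = refl
allB-cong (x ∷ xs) q≗q' = cong₂ _∧_ (q≗q' x) (allB-cong xs q≗q')

allB-applyUpTo-true : ∀ (q : ℕ → Bool) g m → allB q (applyUpTo g m) ≡ true → ∀ k → k < m → q (g k) ≡ true
allB-applyUpTo-true q g (suc m) all-q k k<m with q (g 0) in q0
allB-applyUpTo-true q g (suc m) all-q zero k<m | true = q0
allB-applyUpTo-true q g (suc m) all-q (suc k) k<m | true = allB-applyUpTo-true q (g ∘ suc) m all-q k (s<s⁻¹ k<m)

allB-applyUpTo-false : ∀ (q : ℕ → Bool) g m → allB q (applyUpTo g m) ≡ false → ∃[ k ] q (g k) ≡ false
allB-applyUpTo-false q g (suc m) not-all with q (g 0) in q0
... | false = 0 , q0
... | true = let (k , qk) = allB-applyUpTo-false q (g ∘ suc) m not-all in suc k , qk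

isOrbitMin-cong : {f g : X n → X n} {y : X n} → (∀ k → iter f k y ≡ iter g k y) → isOrbitMin f y ≡ isOrbitMin g y
isOrbitMin-cong {n} {y = y} iters≡ = allB-cong (upTo (n + n)) (λ k → cong (λ z → rank y ≤ᵇ rank z) (iters≡ k))

isOrbitMin-minimal : {f : X n → X n} → Injective f → {y z : X n} → isOrbitMin f y ≡ true → Reach f y z → rank y ≤ rank z
isOrbitMin-minimal {n} {f} inj {y} min (k , refl) with Reach-bounded inj y k
... | k' , k'<n+n , eq = subst (λ z → rank y ≤ rank z) (sym eq)
      (≤ᵇ⇒≤ _ _ (subst T (sym (allB-applyUpTo-true (λ k → rank y ≤ᵇ rank (iter f k y)) id (n + n) min k' k'<n+n)) tt))

isOrbitMin-descends : {f : X n → X n} {y : X n} → isOrbitMin f y ≡ false → ∃[ z ] Reach f y z × rank z < rank y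
isOrbitMin-descends {n} {f} {y} not-min with allB-applyUpTo-false (λ k → rank y ≤ᵇ rank (iter f k y)) id (n + n) not-min
... | k , ≰ = iter f k y , (k , refl) , ≰⇒> (λ ≤ → subst T ≰ (≤⇒≤ᵇ ≤))

isOrbitMin-unique : {f : X n → X n} → Injective f → {y z : X n} → Reach f y z →
  isOrbitMin f y ≡ true → isOrbitMin f z ≡ true → y ≡ z
isOrbitMin-unique inj y↝z min-y min-z =
  rank-injective _ _ (≤-antisym (isOrbitMin-minimal inj min-y y↝z) (isOrbitMin-minimal inj min-z (Reach-sym inj y↝z)))

orbitMin-exists : {f : X n → X n} → ∀ y → ∃[ m ] Reach f y m × isOrbitMin f m ≡ true
orbitMin-exists {f = f} y = descend y (<-wellFounded (rank y))
  where
  descend : ∀ y → Acc _<_ (rank y) → ∃[ m ] Reach f y m × isOrbitMin f m ≡ true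
  descend y (acc smaller) with isOrbitMin f y in min
  ... | true = y , Reach-refl y , min
  ... | false with isOrbitMin-descends min
  ...   | z , y↝z , z<y with descend z (smaller z<y)
  ...     | m , z↝m , min-m = m , Reach-trans y↝z z↝m , min-m

cycles-cong : {D : X n → Bool} {f f' : X n → X n} → (∀ y → f y ≡ f' y) → cycles D f ≡ cycles D f'
cycles-cong {n} {D} f≗f' =
  countB-cong (enumX n) (λ y → cong (D y ∧_) (isOrbitMin-cong (λ k → iter-cong f≗f' k y)))

cyc2-left : (u v : X n) → cyc2 u v u ≡ v
cyc2-left u v = if-≡ {x = u} {u} refl

cyc2-right : (u v : X n) → cyc2 u v v ≡ u
cyc2-right u v with v ≟X u
... | yes v≡u = trans (if-≡ v≡u) v≡u
... | no v≢u = trans (if-≢ v≢u) (if-≡ {x = v} {v} refl)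

cyc2-other : {u v y : X n} → y ≢ u → y ≢ v → cyc2 u v y ≡ y
cyc2-other y≢u y≢v = trans (if-≢ y≢u) (if-≢ y≢v)

cyc2-self : (u y : X n) → cyc2 u u y ≡ y
cyc2-self u y with y ≟X u
... | yes refl = cyc2-left y y
... | no y≢u = cyc2-other y≢u y≢u

cyc2-sym : (u v y : X n) → cyc2 u v y ≡ cyc2 v u y
cyc2-sym u v y with y ≟X u | y ≟X v
... | yes refl | _ = trans (cyc2-left y v) (sym (cyc2-right v y))
... | no _ | yes refl = trans (cyc2-right u y) (sym (cyc2-left y u))
... | no y≢u | no y≢v = trans (cyc2-other y≢u y≢v) (sym (cyc2-other y≢v y≢u))

cyc2-involutive : (u v y : X n) → cyc2 u v (cyc2 u v y) ≡ y
cyc2-involutive u v y with y ≟X u | y ≟X v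
... | yes refl | _ = trans (cong (cyc2 y v) (cyc2-left y v)) (cyc2-right y v)
... | no _ | yes refl = trans (cong (cyc2 u y) (cyc2-right u y)) (cyc2-left u y)
... | no y≢u | no y≢v = trans (cong (cyc2 u v) (cyc2-other y≢u y≢v)) (cyc2-other y≢u y≢v)

cyc2-injective : (u v : X n) → Injective (cyc2 u v)
cyc2-injective u v y z e =
  trans (sym (cyc2-involutive u v y)) (trans (cong (cyc2 u v) e) (cyc2-involutive u v z))

cyc2-conj : {h : X n → X n} → Injective h → ∀ u v y → h (cyc2 u v y) ≡ cyc2 (h u) (h v) (h y)
cyc2-conj {h = h} inj u v y rewrite eqX-injective inj y u | eqX-injective inj y v =
  trans (if-float h (eqX y u)) (cong (if eqX y u then h v else_) (if-float h (eqX y v)))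

cyc3-first : (u v w : X n) → cyc3 u v w u ≡ v
cyc3-first u v w = if-≡ {x = u} {u} refl

cyc3-second : {u v : X n} (w : X n) → v ≢ u → cyc3 u v w v ≡ w
cyc3-second {v = v} w v≢u = trans (if-≢ v≢u) (if-≡ {x = v} {v} refl)

cyc3-third : {u v w : X n} → w ≢ u → w ≢ v → cyc3 u v w w ≡ u
cyc3-third {w = w} w≢u w≢v = trans (if-≢ w≢u) (trans (if-≢ w≢v) (if-≡ {x = w} {w} refl))

cyc3-other : {u v w y : X n} → y ≢ u → y ≢ v → y ≢ w → cyc3 u v w y ≡ y
cyc3-other y≢u y≢v y≢w = trans (if-≢ y≢u) (trans (if-≢ y≢v) (if-≢ y≢w))

cyc3≡cyc2-uv-wu : {u v w : X n} → u ≢ v → w ≢ u → w ≢ v → ∀ y → cyc3 u v w y ≡ cyc2 w u (cyc2 u v y)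
cyc3≡cyc2-uv-wu {u = u} {v} {w} u≢v w≢u w≢v y with y ≟X u | y ≟X v | y ≟X w
... | yes refl | _ | _ = trans (cyc3-first y v w) (sym (trans (cong (cyc2 w y) (cyc2-left y v)) (cyc2-other (≢-sym w≢v) (≢-sym u≢v))))
... | no y≢u | yes refl | _ = trans (cyc3-second w y≢u) (sym (trans (cong (cyc2 w u) (cyc2-right u y)) (cyc2-right w u)))
... | no y≢u | no y≢v | yes refl = trans (cyc3-third y≢u y≢v) (sym (trans (cong (cyc2 y u) (cyc2-other y≢u y≢v)) (cyc2-left y u)))
... | no y≢u | no y≢v | no y≢w = trans (cyc3-other y≢u y≢v y≢w) (sym (trans (cong (cyc2 w u) (cyc2-other y≢u y≢v)) (cyc2-other y≢w y≢u)))

cyc3≡cyc2-vw-vu : {u v w : X n} → u ≢ v → w ≢ u → w ≢ v → ∀ y → cyc3 u v w y ≡ cyc2 v u (cyc2 v w y)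
cyc3≡cyc2-vw-vu {u = u} {v} {w} u≢v w≢u w≢v y with y ≟X u | y ≟X v | y ≟X w
... | yes refl | _ | _ = trans (cyc3-first y v w) (sym (trans (cong (cyc2 v y) (cyc2-other u≢v (≢-sym w≢u))) (cyc2-right v y)))
... | no y≢u | yes refl | _ = trans (cyc3-second w y≢u) (sym (trans (cong (cyc2 y u) (cyc2-left y w)) (cyc2-other w≢v w≢u)))
... | no y≢u | no y≢v | yes refl = trans (cyc3-third y≢u y≢v) (sym (trans (cong (cyc2 v u) (cyc2-right v y)) (cyc2-left v u)))
... | no y≢u | no y≢v | no y≢w = trans (cyc3-other y≢u y≢v y≢w) (sym (trans (cong (cyc2 v u) (cyc2-other y≢v y≢w)) (cyc2-other y≢v y≢u)))

SupportedOn : (X n → Bool) → (X n → X n) → Set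
SupportedOn {n} D f = ∀ y → D y ≡ false → f y ≡ y

del-self : (x : X n) (f : X n → X n) → del x f x ≡ x
del-self x f = if-≡ {x = x} {x} refl

del-skip : {x y : X n} (f : X n → X n) → y ≢ x → f y ≢ x → del x f y ≡ f y
del-skip f y≢x fy≢x = trans (if-≢ y≢x) (if-≢ fy≢x)

del-jump : {x y : X n} (f : X n → X n) → y ≢ x → f y ≡ x → del x f y ≡ f x
del-jump f y≢x fy≡x = trans (if-≢ y≢x) (if-≡ fy≡x)

del-fixed : {x : X n} (f : X n → X n) → f x ≡ x → ∀ y → del x f y ≡ f y
del-fixed {x = x} f fx≡x y with y ≟X x | f y ≟X x
... | yes refl | _ = trans (del-self y f) (sym fx≡x)
... | no y≢x | yes fy≡x = trans (del-jump f y≢x fy≡x) (trans fx≡x (sym fy≡x))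
... | no y≢x | no fy≢x = del-skip f y≢x fy≢x

del-post : {f : X n → X n} → Injective f → ∀ x y → del x f y ≡ cyc2 x (f x) (f y)
del-post {f = f} inj x y with y ≟X x
... | yes refl = trans (del-self y f) (sym (cyc2-right y (f y)))
... | no y≢x with f y ≟X x
...   | yes fy≡x = trans (del-jump f y≢x fy≡x) (sym (trans (cong (cyc2 x (f x)) fy≡x) (cyc2-left x (f x))))
...   | no fy≢x = trans (del-skip f y≢x fy≢x) (sym (cyc2-other fy≢x (λ e → y≢x (inj y x e))))

del-≢ : {x : X n} {f : X n → X n} → Injective f → ∀ {y} → y ≢ x → del x f y ≢ x
del-≢ {x = x} {f} inj {y} y≢x with f y ≟X x
... | yes fy≡x = λ e → y≢x (inj y x (trans fy≡x (sym (trans (sym (del-jump f y≢x fy≡x)) e))))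
... | no fy≢x = λ e → fy≢x (trans (sym (del-skip f y≢x fy≢x)) e)

del-injective : {x : X n} {f : X n → X n} → Injective f → Injective (del x f)
del-injective {x = x} {f} inj y z e with y ≟X x | z ≟X x
... | yes refl | yes refl = refl
... | yes refl | no z≢x = contradiction (trans (sym e) (del-self x f)) (del-≢ inj z≢x)
... | no y≢x | yes refl = contradiction (trans e (del-self x f)) (del-≢ inj y≢x)
... | no y≢x | no z≢x with f y ≟X x | f z ≟X x
...   | yes fy≡x | yes fz≡x = inj y z (trans fy≡x (sym fz≡x))
...   | no fy≢x | no fz≢x = inj y z (trans (sym (del-skip f y≢x fy≢x)) (trans e (del-skip f z≢x fz≢x)))
...   | yes fy≡x | no fz≢x = contradiction (sym (inj x z (trans (sym (del-jump f y≢x fy≡x)) (trans e (del-skip f z≢x fz≢x))))) z≢x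
...   | no fy≢x | yes fz≡x = contradiction (inj y x (trans (sym (del-skip f y≢x fy≢x)) (trans e (del-jump f z≢x fz≡x)))) y≢x

del-supported : {D : X n → Bool} {f : X n → X n} (x : X n) → SupportedOn D f →
  SupportedOn (λ y → D y ∧ not (eqX y x)) (del x f)
del-supported {D = D} {f} x supp y off with y ≟X x
... | yes refl = del-self y f
... | no y≢x with D y in Dy
...   | false = trans (del-skip f y≢x (λ fy≡x → y≢x (trans (sym (supp y Dy)) fy≡x))) (supp y Dy)
...   | true with () ← trans (sym off) (cong not (eqX-≢ y≢x))

del-conj : {f f' h : X n → X n} → Injective h → (∀ y → f' (h y) ≡ h (f y)) →
  ∀ x y → del (h x) f' (h y) ≡ h (del x f y)
del-conj {f = f} {h = h} inj f'h≡hf x y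
  rewrite f'h≡hf y | f'h≡hf x | eqX-injective inj y x | eqX-injective inj (f y) x =
  sym (trans (if-float h (eqX y x)) (cong (if eqX y x then h x else_) (if-float h (eqX (f y) x))))

findInv-inverse : (f : X n → X n) {x y : X n} (xs : List (X n)) → x ∈ xs → f x ≡ y → f (findInv f y xs) ≡ y
findInv-inverse f {y = y} (z ∷ zs) x∈ fx≡y with f z ≟X y
... | yes fz≡y = trans (cong f (if-≡ fz≡y)) fz≡y
... | no fz≢y = trans (cong f (if-≢ fz≢y)) (findInv-inverse f zs (in-tail x∈) fx≡y)
  where
  in-tail : _ ∈ z ∷ zs → _ ∈ zs
  in-tail (here refl) = contradiction fx≡y fz≢y
  in-tail (there x∈zs) = x∈zs

enumX-complete : (x : X n) → x ∈ enumX n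
enumX-complete (inj₁ i) = ∈-++⁺ˡ (∈-map⁺ inj₁ (∈-allFin i))
enumX-complete {n} (inj₂ i) = ∈-++⁺ʳ (map inj₁ (allFin n)) (∈-map⁺ inj₂ (∈-allFin i))

invF-inverse : {f : X n → X n} → Injective f → ∀ y → f (invF f y) ≡ y
invF-inverse {n} {f} inj y with period inj y
... | e , _ , returns = findInv-inverse f (enumX n) (enumX-complete (iter f e y)) returns

-- Cycles after a deletion

module Deletion {n} {f : X n → X n} (inj : Injective f) (x : X n) where

  g : X n → X n
  g = del x f

  Reach-del-avoids : ∀ {y z} → y ≢ x → Reach g y z → z ≢ x
  Reach-del-avoids y≢x (zero , refl) = y≢x
  Reach-del-avoids y≢x (suc k , refl) = del-≢ inj (Reach-del-avoids y≢x (k , refl))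

  Reach-del-step : ∀ {w} → w ≢ x → Reach f w (g w)
  Reach-del-step {w} w≢x with f w ≟X x
  ... | yes fw≡x = 2 , trans (cong f fw≡x) (sym (del-jump f w≢x fw≡x))
  ... | no fw≢x = 1 , sym (del-skip f w≢x fw≢x)

  Reach-del⇒ : ∀ {y z} → y ≢ x → Reach g y z → Reach f y z
  Reach-del⇒ = Reach-simulation (_≢ x) (λ w → Reach-del-step) (λ w → del-≢ inj)

  -- The g-walk tracks the f-walk, pausing on the predecessor of x while the f-walk visits x.
  Tracks : X n → ℕ → Set
  Tracks y k = ∃[ w ] Reach g y w × (w ≡ iter f k y ⊎ (f w ≡ x × iter f k y ≡ x))

  tracks : ∀ {y} → y ≢ x → ∀ k → Tracks y k
  tracks {y} y≢x zero = y , Reach-refl y , inj₁ refl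
  tracks {y} y≢x (suc k) with tracks y≢x k
  ... | w , y↝w , inj₁ refl with f w ≟X x
  ...   | yes fw≡x = w , y↝w , inj₂ (fw≡x , fw≡x)
  ...   | no fw≢x = g w , Reach-trans y↝w (Reach-step w) , inj₁ (del-skip f (Reach-del-avoids y≢x y↝w) fw≢x)
  tracks {y} y≢x (suc k) | w , y↝w , inj₂ (fw≡x , fk≡x) =
    g w , Reach-trans y↝w (Reach-step w) , inj₁ (trans (del-jump f (Reach-del-avoids y≢x y↝w) fw≡x) (cong f (sym fk≡x)))

  Reach⇒del : ∀ {y z} → y ≢ x → Reach f y z → z ≢ x → Reach g y z
  Reach⇒del y≢x (k , refl) z≢x with tracks y≢x k
  ... | w , y↝w , inj₁ w≡z = subst (Reach g _) w≡z y↝w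
  ... | w , y↝w , inj₂ (_ , z≡x) = contradiction z≡x z≢x

  iter-del-off-orbit : ∀ {y} → ¬ Reach f y x → ∀ k → iter g k y ≡ iter f k y
  iter-del-off-orbit y↛x k = sym (proj₁ (iter-agree (λ w → ¬ Reach f w x) agrees closed y↛x k))
    where
    agrees : ∀ w → ¬ Reach f w x → f w ≡ g w
    agrees w w↛x = sym (del-skip f (λ e → w↛x (0 , e)) (λ e → w↛x (1 , e)))
    closed : ∀ w → ¬ Reach f w x → ¬ Reach f (f w) x
    closed w w↛x fw↝x = w↛x (Reach-trans (Reach-step w) fw↝x)

  -- Off the orbit of x, f and g have the same orbit minima; on it, f has one minimum,
  -- and g has one unless f x ≡ x.
  module _ {D : X n → Bool} (supp : SupportedOn D f) (Dx : D x ≡ true) where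

    inOrbit : X n → Bool
    inOrbit y = does (Reach? inj y x)

    orbit-in-D : ∀ {y} → Reach f y x → D y ≡ true
    orbit-in-D {y} (k , e) with D y in Dy
    ... | true = refl
    ... | false = contradiction (trans (sym Dy) (trans (cong D (trans (sym (iter-fixed (supp y Dy) k)) e)) Dx)) λ ()

    counted : X n → Bool
    counted y = D y ∧ isOrbitMin f y

    counted′ : X n → Bool
    counted′ y = (D y ∧ not (eqX y x)) ∧ isOrbitMin g y

    off-orbit : ∀ y → counted y ∧ not (inOrbit y) ≡ counted′ y ∧ not (inOrbit y)
    off-orbit y with Reach? inj y x
    ... | yes _ = trans (∧-zeroʳ _) (sym (∧-zeroʳ _))
    ... | no y↛x = cong (_∧ true) (begin
        D y ∧ isOrbitMin f y                  ≡⟨ cong (_∧ isOrbitMin f y) (sym (∧-identityʳ (D y))) ⟩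
        (D y ∧ true) ∧ isOrbitMin f y         ≡⟨ cong₂ (λ b c → (D y ∧ not b) ∧ c) (sym (eqX-≢ y≢x))
                                                   (isOrbitMin-cong (λ k → sym (iter-del-off-orbit y↛x k))) ⟩
        (D y ∧ not (eqX y x)) ∧ isOrbitMin g y ∎)
      where
      open ≡-Reasoning
      y≢x : y ≢ x
      y≢x refl = y↛x (Reach-refl y)

    counted-on-orbit : ∀ y → counted y ∧ inOrbit y ≡ true → isOrbitMin f y ≡ true × Reach f y x
    counted-on-orbit y e =
      ∧-conicalʳ (D y) _ (∧-conicalˡ (counted y) _ e) , does-true (Reach? inj y x) (∧-conicalʳ (counted y) _ e)

    counted′-on-orbit : ∀ y → counted′ y ∧ inOrbit y ≡ true → y ≢ x × isOrbitMin g y ≡ true × Reach f y x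
    counted′-on-orbit y e =
      eqX-false (not-injective (∧-conicalʳ (D y) _ (∧-conicalˡ (D y ∧ not (eqX y x)) _ counted′-y))) ,
      ∧-conicalʳ (D y ∧ not (eqX y x)) _ counted′-y ,
      does-true (Reach? inj y x) (∧-conicalʳ (counted′ y) _ e)
      where
      counted′-y = ∧-conicalˡ (counted′ y) _ e

    on-orbit : countB (λ y → counted y ∧ inOrbit y) (enumX n) ≡ 1
    on-orbit with orbitMin-exists {f = f} x
    ... | m , x↝m , min-m = countB-point m (≡eqX m-counted only-m)
      where
      m↝x : Reach f m x
      m↝x = Reach-sym inj x↝m
      m-counted : counted m ∧ inOrbit m ≡ true
      m-counted rewrite orbit-in-D m↝x | min-m | dec-true (Reach? inj m x) m↝x = refl
      only-m : ∀ y → counted y ∧ inOrbit y ≡ true → y ≡ m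
      only-m y e = let (min-y , y↝x) = counted-on-orbit y e in
        isOrbitMin-unique inj (Reach-trans y↝x x↝m) min-y min-m

    on-orbit′ : countB (λ y → counted′ y ∧ inOrbit y) (enumX n) + (if eqX (f x) x then 1 else 0) ≡ 1
    on-orbit′ with f x ≟X x
    ... | yes fx≡x = cong₂ _+_ (countB-false (enumX n) none) (if-≡ fx≡x)
      where
      orbit-is-x : ∀ {y} → Reach f y x → y ≡ x
      orbit-is-x (k , e) = iter-injective inj k _ _ (trans e (sym (iter-fixed fx≡x k)))
      none : ∀ y → counted′ y ∧ inOrbit y ≡ false
      none y = ¬-not λ e → let (y≢x , _ , y↝x) = counted′-on-orbit y e in y≢x (orbit-is-x y↝x)
    ... | no fx≢x with orbitMin-exists {f = g} (f x)
    ...   | m , fx↝m , min-m = cong₂ _+_ (countB-point m (≡eqX m-counted only-m)) (if-≢ fx≢x)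
      where
      m≢x : m ≢ x
      m≢x = Reach-del-avoids fx≢x fx↝m
      x↝m : Reach f x m
      x↝m = Reach-trans (Reach-step x) (Reach-del⇒ fx≢x fx↝m)
      m↝x : Reach f m x
      m↝x = Reach-sym inj x↝m
      m-counted : counted′ m ∧ inOrbit m ≡ true
      m-counted rewrite orbit-in-D m↝x | eqX-≢ m≢x | min-m | dec-true (Reach? inj m x) m↝x = refl
      only-m : ∀ y → counted′ y ∧ inOrbit y ≡ true → y ≡ m
      only-m y e = let (y≢x , min-y , y↝x) = counted′-on-orbit y e in
        isOrbitMin-unique (del-injective inj) (Reach⇒del y≢x (Reach-trans y↝x x↝m) m≢x) min-y min-m

    cycles-del : cycles D f ≡ cycles (λ y → D y ∧ not (eqX y x)) g + (if eqX (f x) x then 1 else 0)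
    cycles-del = begin
        countB counted (enumX n)
      ≡⟨ countB-∧-split counted inOrbit (enumX n) ⟩
        countB (λ y → counted y ∧ inOrbit y) (enumX n) + countB (λ y → counted y ∧ not (inOrbit y)) (enumX n)
      ≡⟨ cong₂ _+_ (trans on-orbit (sym on-orbit′)) (countB-cong (enumX n) off-orbit) ⟩
        (on′ + δx) + off′
      ≡⟨ xy∙z≈xz∙y on′ δx off′ ⟩
        on′ + off′ + δx
      ≡⟨ cong (_+ δx) (sym (countB-∧-split counted′ inOrbit (enumX n))) ⟩
        countB counted′ (enumX n) + δx ∎
      where
      open ≡-Reasoning
      on′ = countB (λ y → counted′ y ∧ inOrbit y) (enumX n)
      off′ = countB (λ y → counted′ y ∧ not (inOrbit y)) (enumX n)
      δx = if eqX (f x) x then 1 else 0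

open Deletion using (cycles-del)

-- Proved by deleting the points of D one at a time, which commutes with conjugation.
cycles-conj : {h : X n → X n} → (∀ y → h (h y) ≡ y) → {D D' : X n → Bool} {f f' : X n → X n} →
  (∀ y → D' (h y) ≡ D y) → (∀ y → f' (h y) ≡ h (f y)) →
  Injective f → SupportedOn D f → Injective f' → SupportedOn D' f' → cycles D f ≡ cycles D' f'
cycles-conj {n} {h} hh = induct _ refl
  where
  h-inj : Injective h
  h-inj x y e = trans (sym (hh x)) (trans (cong h e) (hh y))

  induct : ∀ m {D D' : X n → Bool} {f f' : X n → X n} → countB D (enumX n) ≡ m →
    (∀ y → D' (h y) ≡ D y) → (∀ y → f' (h y) ≡ h (f y)) →
    Injective f → SupportedOn D f → Injective f' → SupportedOn D' f' → cycles D f ≡ cycles D' f'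
  induct zero {D} {D'} {f} {f'} size≡0 hD hf inj supp inj' supp' =
    trans (countB-false (enumX n) (λ y → cong (_∧ isOrbitMin f y) (D-empty y)))
          (sym (countB-false (enumX n) (λ y → cong (_∧ isOrbitMin f' y) (D'-empty y))))
    where
    D-empty : ∀ y → D y ≡ false
    D-empty y = ¬-not λ Dy → contradiction (trans (sym (countB-remove y Dy)) size≡0) λ ()
    D'-empty : ∀ y → D' y ≡ false
    D'-empty y = trans (cong D' (sym (hh y))) (trans (hD (h y)) (D-empty (h y)))
  induct (suc m) {D} {D'} {f} {f'} size≡ hD hf inj supp inj' supp' with countB-witness D (enumX n) size≡
  ... | x , Dx = begin
      cycles D f
    ≡⟨ cycles-del inj x supp Dx ⟩
      cycles (λ y → D y ∧ not (eqX y x)) (del x f) + (if eqX (f x) x then 1 else 0)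
    ≡⟨ cong₂ _+_ smaller (cong (λ b → if b then 1 else 0) fixed≡) ⟩
      cycles (λ y → D' y ∧ not (eqX y (h x))) (del (h x) f') + (if eqX (f' (h x)) (h x) then 1 else 0)
    ≡⟨ sym (cycles-del inj' (h x) supp' (trans (hD x) Dx)) ⟩
      cycles D' f' ∎
    where
    open ≡-Reasoning
    fixed≡ : eqX (f x) x ≡ eqX (f' (h x)) (h x)
    fixed≡ = trans (sym (eqX-injective h-inj (f x) x)) (cong (λ z → eqX z (h x)) (sym (hf x)))
    smaller : cycles (λ y → D y ∧ not (eqX y x)) (del x f) ≡ cycles (λ y → D' y ∧ not (eqX y (h x))) (del (h x) f')
    smaller = induct m (suc-injective (trans (sym (countB-remove x Dx)) size≡))
      (λ y → cong₂ (λ b c → b ∧ not c) (hD y) (eqX-injective h-inj y x)) (del-conj {f' = f'} h-inj hf x)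
      (del-injective inj) (del-supported x supp) (del-injective {f = f'} inj') (del-supported (h x) supp')

IsEmbedding-cong : {D : X n → Bool} {c : Fin n → ℕ} {F G : X n → X n} → (∀ y → F y ≡ G y) →
  IsEmbedding D c F → IsEmbedding D c G
IsEmbedding-cong {F = F} {G} F≗G E = record
  { injective = λ x y e → E.injective x y (trans (F≗G x) (trans e (sym (F≗G y))))
  ; fixes-off = λ x off → trans (sym (F≗G x)) (E.fixes-off x off)
  ; block-pres = λ i D-i → let (j , e , cj) = E.block-pres i D-i in j , trans (sym (F≗G _)) e , cj
  ; one-cycle = λ i j D-i D-j cij → let (k , e) = E.one-cycle i j D-i D-j cij in k , trans (sym (iter-cong F≗G k _)) e
  ; θ-reverse = λ i D-i → trans (sym (trans (F≗G _) (cong (G ∘ θ) (F≗G _)))) (E.θ-reverse i D-i)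
  }
  where module E = IsEmbedding E

θ-involutive : (x : X n) → θ (θ x) ≡ x
θ-involutive (inj₁ _) = refl
θ-involutive (inj₂ _) = refl

θ-injective : Injective {n} θ
θ-injective x y e = trans (sym (θ-involutive x)) (trans (cong θ e) (θ-involutive y))

-- The reduction

module Reduction {n} {a b : Fin n} (a≢b : a ≢ b) where

  A B θA θB : X n
  A = inj₁ a
  B = inj₁ b
  θA = inj₂ a
  θB = inj₂ b

  A≢B : A ≢ B
  A≢B e = a≢b (inj₁-injective e)

  θA≢θB : θA ≢ θB
  θA≢θB e = a≢b (inj₂-injective e)

  swapAB swapθ : X n → X n
  swapAB = cyc2 A B
  swapθ = cyc2 θA θB

  swapθ-inj₁ : ∀ i → swapθ (inj₁ i) ≡ inj₁ i
  swapθ-inj₁ i = cyc2-other {u = θA} {θB} (λ ()) (λ ())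

  swapAB-inj₂ : ∀ i → swapAB (inj₂ i) ≡ inj₂ i
  swapAB-inj₂ i = cyc2-other {u = A} {B} (λ ()) (λ ())

  -- conj Q is the product (a,b) Q (θa,θb) in the right action.
  conj : (X n → X n) → X n → X n
  conj F y = swapθ (F (swapAB y))

  conj-injective : {F : X n → X n} → Injective F → Injective (conj F)
  conj-injective inj y z e = cyc2-injective A B y z (inj _ _ (cyc2-injective θA θB _ _ e))

  conj-involutive : (F : X n → X n) → ∀ y → conj (conj F) y ≡ F y
  conj-involutive F y = trans (cyc2-involutive θA θB _) (cong F (cyc2-involutive A B y))

  redQ≡conj : (Q : X n → X n) → Q A ≡ B → Q θB ≡ θA → ∀ y → redQ a b Q y ≡ conj Q y
  redQ≡conj Q QA QθB y = begin
      del θB (del B (swapAB ⨾ Q) ⨾ swapθ) y   ≡⟨ del-fixed (del B (swapAB ⨾ Q) ⨾ swapθ) θB-fixed y ⟩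
      swapθ (del B (swapAB ⨾ Q) y)            ≡⟨ cong swapθ (del-fixed (swapAB ⨾ Q) (trans (cong Q (cyc2-right A B)) QA) y) ⟩
      conj Q y                                ∎
    where
    open ≡-Reasoning
    θB-fixed : swapθ (del B (swapAB ⨾ Q) θB) ≡ θB
    θB-fixed = begin
      swapθ (del B (swapAB ⨾ Q) θB)  ≡⟨ cong swapθ (del-skip {x = B} {θB} (swapAB ⨾ Q) (λ ()) (λ e → contradiction (trans (sym e') e) λ ())) ⟩
      swapθ (Q (swapAB θB))          ≡⟨ cong (swapθ ∘ Q) (swapAB-inj₂ b) ⟩
      swapθ (Q θB)                   ≡⟨ cong swapθ QθB ⟩
      swapθ θA                       ≡⟨ cyc2-left θA θB ⟩
      θB                             ∎
      where e' = trans (cong Q (swapAB-inj₂ b)) QθB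

  module _ {P : X n → X n} (P-inj : Injective P) where

    redPa≡ : ∀ y → redPa P a b y ≡ swapAB (cyc2 A (P B) (P y))
    redPa≡ y with P B ≟X B
    ... | yes PB≡B = begin
        redPa P a b y                  ≡⟨ cong-app (if-≡ PB≡B) y ⟩
        del B P y                      ≡⟨ del-fixed P PB≡B y ⟩
        P y                            ≡⟨ sym (cyc2-involutive A B (P y)) ⟩
        swapAB (swapAB (P y))          ≡⟨ cong (λ v → swapAB (cyc2 A v (P y))) (sym PB≡B) ⟩
        swapAB (cyc2 A (P B) (P y))    ∎
      where open ≡-Reasoning
    ... | no PB≢B with A ≟X P B
    ...   | yes A≡PB = begin
        redPa P a b y                  ≡⟨ cong-app (trans (if-≢ PB≢B) (if-≡ A≡PB)) y ⟩
        del B (P ⨾ cyc2 B A) y         ≡⟨ del-fixed (P ⨾ cyc2 B A) (trans (cong (cyc2 B A) (sym A≡PB)) (cyc2-right B A)) y ⟩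
        cyc2 B A (P y)                 ≡⟨ cyc2-sym B A (P y) ⟩
        swapAB (P y)                   ≡⟨ cong swapAB (sym (cyc2-self A (P y))) ⟩
        swapAB (cyc2 A A (P y))        ≡⟨ cong (λ v → swapAB (cyc2 A v (P y))) A≡PB ⟩
        swapAB (cyc2 A (P B) (P y))    ∎
      where open ≡-Reasoning
    ...   | no A≢PB = begin
        redPa P a b y                  ≡⟨ cong-app (trans (if-≢ PB≢B) (if-≢ A≢PB)) y ⟩
        del B (P ⨾ cyc3 B A (P B)) y   ≡⟨ del-fixed (P ⨾ cyc3 B A (P B)) (cyc3-third PB≢B (≢-sym A≢PB)) y ⟩
        cyc3 B A (P B) (P y)           ≡⟨ cyc3≡cyc2-vw-vu (≢-sym A≢B) PB≢B (≢-sym A≢PB) (P y) ⟩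
        swapAB (cyc2 A (P B) (P y))    ∎
      where open ≡-Reasoning

    redPa-injective : Injective (redPa P a b)
    redPa-injective y z e = P-inj y z (cyc2-injective A (P B) _ _ (cyc2-injective A B _ _
      (trans (sym (redPa≡ y)) (trans e (redPa≡ z)))))

    preθB : X n
    preθB = invF (redPa P a b) θB

    redPa-preθB : redPa P a b preθB ≡ θB
    redPa-preθB = invF-inverse redPa-injective θB

    redP≡ : ∀ y → redP P a b y ≡ redPa P a b (cyc2 preθB θA (swapθ y))
    redP≡ y with preθB ≟X θB
    ... | yes c≡θB = begin
        redP P a b y                 ≡⟨ cong-app (if-≡ c≡θB) y ⟩
        del θB Pa y                  ≡⟨ del-fixed Pa (trans (cong Pa (sym c≡θB)) redPa-preθB) y ⟩
        Pa y                         ≡⟨ cong Pa (sym (trans (cyc2-sym θB θA (swapθ y)) (cyc2-involutive θA θB y))) ⟩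
        Pa (cyc2 θB θA (swapθ y))    ≡⟨ cong (λ v → Pa (cyc2 v θA (swapθ y))) (sym c≡θB) ⟩
        Pa (cyc2 preθB θA (swapθ y)) ∎
      where
      open ≡-Reasoning
      Pa = redPa P a b
    ... | no c≢θB with θA ≟X preθB
    ...   | yes θA≡c = begin
        redP P a b y                 ≡⟨ cong-app (trans (if-≢ c≢θB) (if-≡ θA≡c)) y ⟩
        del θB (cyc2 θB θA ⨾ Pa) y   ≡⟨ del-fixed (cyc2 θB θA ⨾ Pa) (trans (cong Pa (trans (cyc2-left θB θA) θA≡c)) redPa-preθB) y ⟩
        Pa (cyc2 θB θA y)            ≡⟨ cong Pa (trans (cyc2-sym θB θA y) (sym (cyc2-self θA (swapθ y)))) ⟩
        Pa (cyc2 θA θA (swapθ y))    ≡⟨ cong (λ v → Pa (cyc2 v θA (swapθ y))) θA≡c ⟩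
        Pa (cyc2 preθB θA (swapθ y)) ∎
      where
      open ≡-Reasoning
      Pa = redPa P a b
    ...   | no θA≢c = begin
        redP P a b y                 ≡⟨ cong-app (trans (if-≢ c≢θB) (if-≢ θA≢c)) y ⟩
        del θB (cyc3 θA θB preθB ⨾ Pa) y
                                     ≡⟨ del-fixed (cyc3 θA θB preθB ⨾ Pa) (trans (cong Pa (cyc3-second preθB (≢-sym θA≢θB))) redPa-preθB) y ⟩
        Pa (cyc3 θA θB preθB y)      ≡⟨ cong Pa (cyc3≡cyc2-uv-wu θA≢θB (≢-sym θA≢c) c≢θB y) ⟩
        Pa (cyc2 preθB θA (swapθ y)) ∎
      where
      open ≡-Reasoning
      Pa = redPa P a b

  conj-θB : {Q : X n → X n} → Q θB ≡ θA → conj Q θB ≡ θB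
  conj-θB {Q} QθB = trans (cong (swapθ ∘ Q) (swapAB-inj₂ b)) (trans (cong swapθ QθB) (cyc2-left θA θB))

  module Count {P Q : X n → X n} (P-inj : Injective P) (Q-inj : Injective Q) (QA : Q A ≡ B) (QθB : Q θB ≡ θA) where

    σ s ρ : X n → X n
    σ = P ⨾ Q
    s = del B σ
    ρ y = swapθ (s (swapθ y))

    σ-inj : Injective σ
    σ-inj y z e = P-inj y z (Q-inj _ _ e)

    s-inj : Injective s
    s-inj = del-injective σ-inj

    ρ-inj : Injective ρ
    ρ-inj y z e = cyc2-injective θA θB y z (s-inj _ _ (cyc2-injective θA θB _ _ e))

    s≡ : ∀ y → s y ≡ Q (swapAB (redPa P a b y))
    s≡ y = begin
      del B σ y                                 ≡⟨ del-post σ-inj B y ⟩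
      cyc2 B (Q (P B)) (Q (P y))                ≡⟨ cong (λ v → cyc2 v (Q (P B)) (Q (P y))) (sym QA) ⟩
      cyc2 (Q A) (Q (P B)) (Q (P y))            ≡⟨ sym (cyc2-conj Q-inj A (P B) (P y)) ⟩
      Q (cyc2 A (P B) (P y))                    ≡⟨ cong Q (sym (cyc2-involutive A B _)) ⟩
      Q (swapAB (swapAB (cyc2 A (P B) (P y))))  ≡⟨ cong (Q ∘ swapAB) (sym (redPa≡ P-inj y)) ⟩
      Q (swapAB (redPa P a b y))                ∎
      where open ≡-Reasoning

    s-preθB : s (preθB P-inj) ≡ θA
    s-preθB = trans (s≡ _) (trans (cong (Q ∘ swapAB) (redPa-preθB P-inj)) (trans (cong Q (swapAB-inj₂ b)) QθB))

    del-ρ≡ : ∀ y → del θB ρ y ≡ redQ a b Q (redP P a b y)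
    del-ρ≡ y = begin
      del θB ρ y                                         ≡⟨ del-post ρ-inj θB y ⟩
      cyc2 θB (swapθ (s (swapθ θB))) (ρ y)               ≡⟨ cong₂ (λ u v → cyc2 u (swapθ (s v)) (ρ y)) (sym (cyc2-left θA θB)) (cyc2-right θA θB) ⟩
      cyc2 (swapθ θA) (swapθ (s θA)) (swapθ (s (swapθ y)))
                                                         ≡⟨ sym (cyc2-conj (cyc2-injective θA θB) θA (s θA) (s (swapθ y))) ⟩
      swapθ (cyc2 θA (s θA) (s (swapθ y)))               ≡⟨ cong (λ u → swapθ (cyc2 u (s θA) (s (swapθ y)))) (sym s-preθB) ⟩
      swapθ (cyc2 (s c) (s θA) (s (swapθ y)))            ≡⟨ cong swapθ (sym (cyc2-conj s-inj c θA (swapθ y))) ⟩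
      swapθ (s (cyc2 c θA (swapθ y)))                    ≡⟨ cong swapθ (s≡ _) ⟩
      conj Q (redPa P a b (cyc2 c θA (swapθ y)))         ≡⟨ cong (conj Q) (sym (redP≡ P-inj y)) ⟩
      conj Q (redP P a b y)                              ≡⟨ sym (redQ≡conj Q QA QθB (redP P a b y)) ⟩
      redQ a b Q (redP P a b y)                          ∎
      where
      open ≡-Reasoning
      c = preθB P-inj

    D₁ : X n → Bool
    D₁ y = fullD y ∧ not (eqX y B)

    supported-D₁ : {F : X n → X n} → F B ≡ B → SupportedOn D₁ F
    supported-D₁ {F} FB y off = subst (λ z → F z ≡ z) (sym (eqX-true (not-injective off))) FB

    D₁-swapθ : ∀ y → D₁ (swapθ y) ≡ D₁ y
    D₁-swapθ y = cong not (trans (cong (eqX (swapθ y)) (sym (swapθ-inj₁ b))) (eqX-injective (cyc2-injective θA θB) y B))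

    s-B : s B ≡ B
    s-B = del-self B σ

    ρ-B : ρ B ≡ B
    ρ-B = trans (cong (swapθ ∘ s) (swapθ-inj₁ b)) (trans (cong swapθ s-B) (swapθ-inj₁ b))

    σ-fixes-B : eqX (σ B) B ≡ eqX A (P B)
    σ-fixes-B = begin
      eqX (Q (P B)) B      ≡⟨ cong (eqX (Q (P B))) (sym QA) ⟩
      eqX (Q (P B)) (Q A)  ≡⟨ eqX-injective Q-inj (P B) A ⟩
      eqX (P B) A          ≡⟨ eqX-sym (P B) A ⟩
      eqX A (P B)          ∎
      where open ≡-Reasoning

    ρ-fixes-θB : eqX (ρ θB) θB ≡ eqX (redPa P a b θA) θB
    ρ-fixes-θB = begin
      eqX (swapθ (s (swapθ θB))) θB               ≡⟨ cong₂ eqX (cong swapθ (trans (cong s (cyc2-right θA θB)) (s≡ θA))) (sym (conj-θB {Q = Q} QθB)) ⟩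
      eqX (conj Q (redPa P a b θA)) (conj Q θB)   ≡⟨ eqX-injective (conj-injective Q-inj) (redPa P a b θA) θB ⟩
      eqX (redPa P a b θA) θB                     ∎
      where open ≡-Reasoning

    cycles-reduction : cycles fullD (P ⨾ Q)
      ≡ cycles (redD b) (redP P a b ⨾ redQ a b Q) + δ A (P B) + δ (redPa P a b θA) θB
    cycles-reduction = begin
        cycles fullD σ
      ≡⟨ cycles-del σ-inj B (λ _ ()) refl ⟩
        cycles D₁ s + δ (σ B) B
      ≡⟨ cong (_+ δ (σ B) B) (cycles-conj {h = swapθ} (cyc2-involutive θA θB) {D₁} {D₁} {s} {ρ} D₁-swapθ (λ y → cong (swapθ ∘ s) (cyc2-involutive θA θB y))
                                            s-inj (supported-D₁ s-B) ρ-inj (supported-D₁ ρ-B)) ⟩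
        cycles D₁ ρ + δ (σ B) B
      ≡⟨ cong (_+ δ (σ B) B) (cycles-del ρ-inj θB (supported-D₁ ρ-B) refl) ⟩
        cycles (redD b) (del θB ρ) + δ (ρ θB) θB + δ (σ B) B
      ≡⟨ cong₂ (λ r d → r + d + δ (σ B) B) (cycles-cong del-ρ≡) (cong (λ e → if e then 1 else 0) ρ-fixes-θB) ⟩
        reduced + δ (redPa P a b θA) θB + δ (σ B) B
      ≡⟨ cong (λ e → reduced + δ (redPa P a b θA) θB + (if e then 1 else 0)) σ-fixes-B ⟩
        reduced + δ (redPa P a b θA) θB + δ A (P B)
      ≡⟨ xy∙z≈xz∙y reduced _ _ ⟩
        reduced + δ A (P B) + δ (redPa P a b θA) θB
      ∎
      where
      open ≡-Reasoning
      reduced = cycles (redD b) (redP P a b ⨾ redQ a b Q)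

  del-B≡ : {Q : X n → X n} → Injective Q → Q A ≡ B → ∀ y → del B Q y ≡ Q (swapAB y)
  del-B≡ {Q} Q-inj QA y = begin
    del B Q y                ≡⟨ del-post Q-inj B y ⟩
    cyc2 B (Q B) (Q y)       ≡⟨ cong (λ u → cyc2 u (Q B) (Q y)) (sym QA) ⟩
    cyc2 (Q A) (Q B) (Q y)   ≡⟨ sym (cyc2-conj Q-inj A B y) ⟩
    Q (swapAB y)             ∎
    where open ≡-Reasoning

  redQ-inverse : (Q : X n → X n) → Q A ≡ B → Q θB ≡ θA → ∀ y → conj (redQ a b Q) y ≡ Q y
  redQ-inverse Q QA QθB y = trans (cong swapθ (redQ≡conj Q QA QθB (swapAB y))) (conj-involutive Q y)

  module Bijection (c : Fin n → ℕ) (cab : c a ≡ c b) where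

    BlockPres : (X n → X n) → Set
    BlockPres F = ∀ i → Σ (Fin n) λ j → F (inj₁ i) ≡ inj₁ j × c j ≡ c i

    Reverses : (X n → X n) → Set
    Reverses F = ∀ i → F (θ (F (inj₁ i))) ≡ θ (inj₁ i)

    swapAB-block : BlockPres swapAB
    swapAB-block i with inj₁ i ≟X A | inj₁ i ≟X B
    ... | yes refl | _ = b , cyc2-left A B , sym cab
    ... | no _ | yes refl = a , cyc2-right A B , cab
    ... | no i≢a | no i≢b = i , cyc2-other i≢a i≢b , refl

    conj-on-S : (F : X n → X n) → BlockPres F → ∀ i → conj F (inj₁ i) ≡ F (swapAB (inj₁ i))
    conj-on-S F F-block i with swapAB-block i
    ... | i' , e , _ with F-block i'
    ...   | j , e' , _ = trans (cong swapθ (trans (cong F e) e')) (trans (swapθ-inj₁ j) (sym (trans (cong F e) e')))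

    conj-block : (F : X n → X n) → BlockPres F → BlockPres (conj F)
    conj-block F F-block i with swapAB-block i
    ... | i' , e , ci' with F-block i'
    ...   | j , e' , cj = j , trans (conj-on-S F F-block i) (trans (cong F e) e') , trans cj ci'

    conj-reverses : (F : X n → X n) → BlockPres F → Reverses F → Reverses (conj F)
    conj-reverses F F-block F-rev i with swapAB-block i
    ... | i' , e , _ with F-block i'
    ...   | j , e' , _ = begin
        conj F (θ (conj F (inj₁ i)))   ≡⟨ cong (conj F ∘ θ) (trans (conj-on-S F F-block i) (trans (cong F e) e')) ⟩
        swapθ (F (swapAB (inj₂ j)))    ≡⟨ cong (swapθ ∘ F) (swapAB-inj₂ j) ⟩
        swapθ (F (θ (inj₁ j)))         ≡⟨ cong (swapθ ∘ F ∘ θ) (sym e') ⟩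
        swapθ (F (θ (F (inj₁ i'))))    ≡⟨ cong swapθ (F-rev i') ⟩
        swapθ (θ (inj₁ i'))            ≡⟨ cong (swapθ ∘ θ) (sym e) ⟩
        swapθ (θ (swapAB (inj₁ i)))    ≡⟨ cong swapθ (cyc2-conj {h = θ} θ-injective A B (inj₁ i)) ⟩
        swapθ (swapθ (θ (inj₁ i)))     ≡⟨ cyc2-involutive θA θB (θ (inj₁ i)) ⟩
        θ (inj₁ i)                     ∎
      where open ≡-Reasoning

    redD-inj₁ : ∀ {i} → inj₁ i ≢ B → redD b (inj₁ i) ≡ true
    redD-inj₁ i≢b rewrite eqX-≢ i≢b = refl

    redD-inj₁⁻ : ∀ {i} → redD b (inj₁ i) ≡ true → inj₁ i ≢ B
    redD-inj₁⁻ D-i refl rewrite eqX-≡ {x = B} refl with () ← D-i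

    redD-false : ∀ {y} → redD b y ≡ false → y ≡ B ⊎ y ≡ θB
    redD-false {y} off with y ≟X B | y ≟X θB
    ... | yes y≡B | _ = inj₁ y≡B
    ... | no _ | yes y≡θB = inj₂ y≡θB
    ... | no y≢B | no y≢θB rewrite eqX-≢ y≢B | eqX-≢ y≢θB with () ← off

    module _ {Q : X n → X n} (E : IsEmbedding fullD c Q) (QA : Q A ≡ B) (QθB : Q θB ≡ θA) where
      private module E = IsEmbedding E

      Q-block : BlockPres Q
      Q-block i = E.block-pres i refl

      conj-embedding : IsEmbedding (redD b) c (conj Q)
      conj-embedding = record
        { injective = conj-injective E.injective
        ; fixes-off = fixes-off
        ; block-pres = λ i _ → conj-block Q Q-block i
        ; one-cycle = one-cycle
        ; θ-reverse = λ i _ → conj-reverses Q Q-block (λ i → E.θ-reverse i refl) i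
        }
        where
        fixes-off : ∀ y → redD b y ≡ false → conj Q y ≡ y
        fixes-off y off with redD-false {y} off
        ... | inj₁ refl = trans (cong (swapθ ∘ Q) (cyc2-right A B)) (trans (cong swapθ QA) (swapθ-inj₁ b))
        ... | inj₂ refl = conj-θB {Q} QθB
        -- On S, conj Q agrees with Q / b, whose orbits are those of Q with b removed.
        one-cycle : ∀ i j → redD b (inj₁ i) ≡ true → redD b (inj₁ j) ≡ true → c i ≡ c j → Reach (conj Q) (inj₁ i) (inj₁ j)
        one-cycle i j D-i D-j cij =
          Reach-agree InS agrees closed (i , refl)
            (Reach⇒del (redD-inj₁⁻ D-i) (E.one-cycle i j refl refl cij) (redD-inj₁⁻ D-j))
          where
          open Deletion E.injective B using (Reach⇒del)
          InS : X n → Set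
          InS y = Σ (Fin n) λ m → y ≡ inj₁ m
          agrees : ∀ w → InS w → del B Q w ≡ conj Q w
          agrees w (m , refl) = trans (del-B≡ E.injective QA (inj₁ m)) (sym (conj-on-S Q Q-block m))
          closed : ∀ w → InS w → InS (del B Q w)
          closed w (m , refl) = let (j , e , _) = conj-block Q Q-block m in j , trans (agrees (inj₁ m) (m , refl)) e

    module _ {R : X n → X n} (E : IsEmbedding (redD b) c R) where
      private module E = IsEmbedding E

      R-B : R B ≡ B
      R-B = E.fixes-off B off
        where
        off : redD b B ≡ false
        off rewrite eqX-≡ {x = B} refl = refl

      R-θB : R θB ≡ θB
      R-θB = E.fixes-off θB off
        where
        off : redD b θB ≡ false
        off rewrite eqX-≡ {x = θB} refl = refl

      R-block : BlockPres R
      R-block i with inj₁ i ≟X B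
      ... | yes refl = b , R-B , refl
      ... | no i≢b = E.block-pres i (redD-inj₁ i≢b)

      R-reverses : Reverses R
      R-reverses i with inj₁ i ≟X B
      ... | yes refl = trans (cong (R ∘ θ) R-B) R-θB
      ... | no i≢b = E.θ-reverse i (redD-inj₁ i≢b)

      conjA : conj R A ≡ B
      conjA = trans (cong (swapθ ∘ R) (cyc2-left A B)) (trans (cong swapθ R-B) (swapθ-inj₁ b))

      conjθB : conj R θB ≡ θA
      conjθB = trans (cong (swapθ ∘ R) (swapAB-inj₂ b)) (trans (cong swapθ R-θB) (cyc2-right θA θB))

      conj-InDom : InDom c a b (conj R)
      conj-InDom = record
        { injective = Q-inj
        ; fixes-off = λ _ ()
        ; block-pres = λ i _ → conj-block R R-block i
        ; one-cycle = one-cycle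
        ; θ-reverse = λ i _ → conj-reverses R R-block R-reverses i
        } , conjA , conjθB
        where
        Q : X n → X n
        Q = conj R
        Q-inj : Injective Q
        Q-inj = conj-injective E.injective
        -- Q runs through the cycles of R with b inserted after a.
        Good : X n → Set
        Good w = Σ (Fin n) λ m → w ≡ inj₁ m × inj₁ m ≢ B
        step : ∀ w → Good w → Reach Q w (R w)
        step w (m , refl , m≢b) with inj₁ m ≟X A
        ... | yes refl = 2 , trans (cong Q conjA) (trans (conj-on-S R R-block b) (cong R (cyc2-right A B)))
        ... | no m≢a = 1 , trans (conj-on-S R R-block m) (cong R (cyc2-other m≢a m≢b))
        closed : ∀ w → Good w → Good (R w)
        closed w (m , refl , m≢b) with R-block m
        ... | j , e , _ = j , e , λ j≡b → m≢b (E.injective _ _ (trans e (trans j≡b (sym R-B))))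
        toward : ∀ i → Σ (Fin n) λ i° → inj₁ i° ≢ B × c i° ≡ c i × Reach Q (inj₁ i) (inj₁ i°) × Reach Q (inj₁ i°) (inj₁ i)
        toward i with inj₁ i ≟X B
        ... | yes refl = a , A≢B , cab , Reach-sym Q-inj (1 , conjA) , (1 , conjA)
        ... | no i≢b = i , i≢b , refl , Reach-refl _ , Reach-refl _
        one-cycle : ∀ i j → fullD (inj₁ i) ≡ true → fullD (inj₁ j) ≡ true → c i ≡ c j → Reach Q (inj₁ i) (inj₁ j)
        one-cycle i j _ _ cij with toward i | toward j
        ... | i° , i°≢b , ci° , i↝i° , _ | j° , j°≢b , cj° , _ , j°↝j =
          Reach-trans i↝i° (Reach-trans (Reach-simulation Good step closed (i° , refl , i°≢b) i°↝j°) j°↝j)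
          where
          i°↝j° : Reach R (inj₁ i°) (inj₁ j°)
          i°↝j° = E.one-cycle i° j° (redD-inj₁ i°≢b) (redD-inj₁ j°≢b) (trans ci° (trans cij (sym cj°)))

    redQ-embedding : (Q : X n → X n) → InDom c a b Q → IsEmbedding (redD b) c (redQ a b Q)
    redQ-embedding Q (E , QA , QθB) = IsEmbedding-cong (λ y → sym (redQ≡conj Q QA QθB y)) (conj-embedding E QA QθB)

    redQ-injective : (Q₁ Q₂ : X n → X n) → InDom c a b Q₁ → InDom c a b Q₂ →
      (∀ x → redQ a b Q₁ x ≡ redQ a b Q₂ x) → ∀ x → Q₁ x ≡ Q₂ x
    redQ-injective Q₁ Q₂ (_ , QA₁ , QθB₁) (_ , QA₂ , QθB₂) same x =
      trans (sym (redQ-inverse Q₁ QA₁ QθB₁ x)) (trans (cong swapθ (same (swapAB x))) (redQ-inverse Q₂ QA₂ QθB₂ x))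

    redQ-surjective : (R : X n → X n) → IsEmbedding (redD b) c R →
      Σ (X n → X n) λ Q → InDom c a b Q × (∀ x → redQ a b Q x ≡ R x)
    redQ-surjective R E =
      conj R , conj-InDom E , λ x → trans (redQ≡conj (conj R) (conjA E) (conjθB E) x) (conj-involutive R x)

mainTheorem2 : (n : ℕ) (P : X n → X n) (c : Fin n → ℕ) (a b : Fin n) →
    IsPairPerm P →
    a ≢ b → θ (inj₁ a) ≢ θ (inj₁ b) → c a ≡ c b →
    ((Q : X n → X n) → InDom c a b Q → IsEmbedding (redD b) c (redQ a b Q))
    × ((Q₁ Q₂ : X n → X n) → InDom c a b Q₁ → InDom c a b Q₂ →
         (∀ x → redQ a b Q₁ x ≡ redQ a b Q₂ x) → ∀ x → Q₁ x ≡ Q₂ x)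
    × ((R : X n → X n) → IsEmbedding (redD b) c R →
         Σ (X n → X n) λ Q → InDom c a b Q × (∀ x → redQ a b Q x ≡ R x))
    × ((Q : X n → X n) → InDom c a b Q →
         cycles fullD (P ⨾ Q)
           ≡ cycles (redD b) (redP P a b ⨾ redQ a b Q)
             + δ (inj₁ a) (P (inj₁ b))
             + δ (redPa P a b (θ (inj₁ a))) (θ (inj₁ b)))
mainTheorem2 n P c a b P-pair a≢b _ cab =
  redQ-embedding , redQ-injective , redQ-surjective ,
  λ Q (E , QA , QθB) → Count.cycles-reduction (IsPairPerm.injective P-pair) (IsEmbedding.injective E) QA QθB
  where
  open Reduction a≢b
  open Bijection c cab
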